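{- Let $\mathcal{G}$ be a finite quiver (self-loops allowed, at most one directed edge from any vertex to any other vertex). A walk $w$ on $\mathcal{G}$ is irreducible in $K\mathcal{G}_\odot$ if and only if $w\in\Pi_{\mathcal{G}}\cup\Gamma_{\mathcal{G}}$, where $\Pi_{\mathcal{G}}$ is the set of simple paths and $\Gamma_{\mathcal{G}}$ the set of simple cycles of $\mathcal{G}$. Moreover, the irreducible walks are exactly the prime elements of $K\mathcal{G}_\odot$.
   Context: A walk of length $n\ge 1$ on $\mathcal{G}$ is a sequence of contiguous edges $(\mu_0\mu_1)(\mu_1\mu_2)\cdots(\mu_{n-1}\mu_n)$, described by its vertex string $(\mu_0\,\mu_1\cdots\mu_n)$. For each vertex $\mu$ there is a trivial walk $(\mu)$ of length $0$. A walk with $\mu_0=\mu_n$ is a cycle (off $\mu_0$), otherwise it is open. A simple path is an open walk whose vertices are all distinct; a simple cycle is a cycle whose internal vertices are all distinct and different from its initial vertex; a trivial walk counts as both a simple path and a simple cycle. Canonical couple: let $b=(\beta\,\beta_2\cdots\beta_q\,\beta)$ be a cycle off $\beta$ and $a=(\alpha_1\cdots\alpha_k)$ a walk visiting $\beta$, and let $\alpha_j=\beta$ be the last appearance of $\beta$ in $a$. Then $(a,b)$ is canonical iff either (i) $a$ and $b$ are both cycles off $\beta$, or (ii) no vertex $\alpha_i\neq\beta$ with $i<j$ is visited by $b$. Nesting product: if $(w_1,w_2)$ is canonical with $w_2$ a cycle off $\beta$, then $w_1\odot w_2$ is the walk whose vertex string is obtained from that of $w_1$ by replacing the last appearance of $\beta$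 by the entire vertex string of $w_2$; for all other pairs $w\odot w'=0$, with $0$ absorbing. $K\mathcal{G}_\odot$: for $K$ an algebraically closed field, the near $K$-algebra with basis the set of walks, product the nesting product, and addition of two walks nonzero only if they share initial and final vertices. Divisibility: $w'\mid w$ iff there exist walks $a,b$ with $w=(a\odot w')\odot b$ or $w=a\odot(w'\odot b)$. A walk $w$ is irreducible iff whenever a walk $a$ satisfies $a\mid w$, either $a$ is trivial or $a=w$ up to nesting with trivial walks. A walk $w$ is prime iff $w\mid a\odot b$ implies $w\mid a$ or $w\mid b$. -}

module Defs where

open import Data.Nat using (ℕ)
open import Data.Fin using (Fin)
open import Data.Bool using (Bool; T)
open import Data.Unit using (⊤)
open import Data.Empty using (⊥)
open import Data.Maybe using (Maybe; just; nothing)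
open import Data.List using (List; []; _∷_; _++_; _∷ʳ_; head; last; length)
open import Data.List.Membership.Propositional using (_∈_; _∉_)
open import Data.List.Relation.Unary.Unique.Propositional using (Unique)
open import Data.Product using (Σ; ∃; ∃-syntax; _×_)
open import Data.Sum using (_⊎_)
open import Relation.Nullary using (¬_)
open import Relation.Binary.PropositionalEquality using (_≡_; _≢_)

-- A finite quiver on the vertex set Fin n with self-loops allowed and at most
-- one directed edge from any vertex to any vertex: an adjacency relation.
Quiver : ℕ → Set
Quiver n = Fin n → Fin n → Bool

module _ {n : ℕ} (G : Quiver n) where

  -- A walk is identified with its (nonempty) vertex string (μ₀ μ₁ ⋯ μₖ),
  -- consecutive vertices being joined by an edge of G.
  IsWalk : List (Fin n) → Set
  IsWalk []            = ⊥
  IsWalk (x ∷ [])      = ⊤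
  IsWalk (x ∷ y ∷ r)   = T (G x y) × IsWalk (y ∷ r)

  -- Trivial walk (μ): vertex string of length one (walk of length 0).
  Trivial : List (Fin n) → Set
  Trivial w = length w ≡ 1

  CycleOff : Fin n → List (Fin n) → Set
  CycleOff β w = IsWalk w × head w ≡ just β × last w ≡ just β

  -- Nest a b c  :⇔  a ⊙ b = c (≠ 0).  b is a cycle off β; a = p ++ β ∷ s
  -- with β ∉ s (so the displayed β is the last appearance of β in a, and p
  -- lists the vertices α_i, i < j); (a,b) is canonical; c replaces that last
  -- β by the whole vertex string of b.
  Nest : List (Fin n) → List (Fin n) → List (Fin n) → Set
  Nest a b c =
    IsWalk a × Σ (Fin n) λ β → Σ (List (Fin n)) λ p → Σ (List (Fin n)) λ s →
      CycleOff β b × a ≡ p ++ (β ∷ s) × β ∉ s ×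
      (CycleOff β a ⊎ (∀ x → x ∈ p → x ≢ β → x ∉ b)) ×
      c ≡ p ++ b ++ s

  -- Multiplication by an optional outer factor (nothing = empty factor).
  LeftMul : Maybe (List (Fin n)) → List (Fin n) → List (Fin n) → Set
  LeftMul nothing  w x = x ≡ w
  LeftMul (just a) w x = Nest a w x

  RightMul : List (Fin n) → Maybe (List (Fin n)) → List (Fin n) → Set
  RightMul w nothing  x = x ≡ w
  RightMul w (just b) x = Nest w b x

  Divides : List (Fin n) → List (Fin n) → Set
  Divides w' w = Σ (Maybe (List (Fin n))) λ a → Σ (Maybe (List (Fin n))) λ b →
      (∃[ x ] (LeftMul a w' x × RightMul x b w))
    ⊎ (∃[ y ] (RightMul w' b y × LeftMul a y w))

  Irreducible : List (Fin n) → Set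
  Irreducible w = IsWalk w × (∀ a → IsWalk a → Divides a w → Trivial a ⊎ a ≡ w)

  Prime : List (Fin n) → Set
  Prime w = IsWalk w × (∀ a b c → Nest a b c → Divides w c → Divides w a ⊎ Divides w b)

  -- Simple paths Π_G (open, all vertices distinct; trivial walks included).
  SimplePath : List (Fin n) → Set
  SimplePath w = IsWalk w × (Trivial w ⊎ (head w ≢ last w × Unique w))

  -- Simple cycles Γ_G (internal vertices distinct and ≠ initial vertex;
  -- trivial walks included).
  SimpleCycle : List (Fin n) → Set
  SimpleCycle w = IsWalk w × (Trivial w ⊎
    (Σ (Fin n) λ β → Σ (List (Fin n)) λ i → w ≡ (β ∷ i) ∷ʳ β × Unique (β ∷ i)))

module Submission where

-- Call a walk w rigid if its only nesting factorisations a ⊙ b = w are the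
-- trivial ones (one factor trivial, the other equal to w).  The proof has
-- three parts.
--  (1) Simple paths and simple cycles are rigid: the cycle b = (β ⋯ β) of a
--      product a ⊙ b repeats β, and a simple walk repeats a vertex only at
--      its two ends, which forces b to be the whole walk.
--  (2) Rigid walks are irreducible and prime.
--      Primality rests on the diamond lemma: two factorisations a ⊙ b = d ⊙ z
--      of one walk either nest one cycle inside the other or insert the two
--      cycles at independent places, so a divisor of the product can be
--      traced into one of the factors.
--  (3) Every other walk has a proper factorisation a ⊙ b (both factors with
--      at least two vertices), obtained by cutting out the cycle at the first
--      repeated vertex.  Such a walk is neither irreducible nor prime, since
--      each factor is strictly shorter than the product.

open import Defs
open import Data.Nat using (ℕ; suc; _+_; _≤_; _<_; z≤n; s≤s; s≤s⁻¹)
open import Data.Nat.Properties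
  using (+-suc; +-assoc; +-comm; ≤-trans; ≤-reflexive; ≤-antisym; +-monoˡ-≤; ≤-<-trans; <-irrefl)
open import Data.Fin using (Fin; _≟_)
open import Data.List using (List; []; _∷_; _++_; _∷ʳ_; head; last; length; initLast; _∷ʳ′_)
open import Data.List.Properties using (++-assoc; ++-identityʳ; ∷-injective; ++-cancelˡ; length-++; ∷ʳ-injective)
open import Data.List.Membership.Propositional using (_∈_; _∉_)
open import Data.List.Membership.Propositional.Properties using (∈-++⁺ˡ; ∈-++⁺ʳ; ∈-++⁻; ∈-∃++)
open import Data.List.Relation.Unary.Any using (here; there)
open import Data.List.Relation.Unary.All using ([])
open import Data.List.Relation.Unary.All.Properties using (¬Any⇒All¬)
open import Data.List.Relation.Unary.AllPairs using ([]; _∷_)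
open import Data.List.Relation.Unary.Unique.Propositional using (Unique)
open import Data.List.Relation.Unary.Unique.Propositional.Properties as Unique using (Unique[x∷xs]⇒x∉xs)
open import Data.Maybe using (Maybe; just; nothing)
open import Data.Maybe.Properties using (just-injective)
open import Data.Product using (Σ; _×_; _,_; proj₁; proj₂)
open import Data.Sum using (_⊎_; inj₁; inj₂)
open import Data.Empty using (⊥; ⊥-elim)
open import Data.Unit using (tt)
open import Function.Base using (_∘_)
open import Function.Bundles using (_⇔_; mk⇔)
open import Relation.Nullary using (yes; no)
open import Relation.Binary.Definitions using (DecidableEquality)
open import Relation.Binary.PropositionalEquality
  using (_≡_; _≢_; refl; sym; trans; cong; subst; module ≡-Reasoning)

module _ {A : Set} where

  ++-split : ∀ (xs ys us vs : List A) → xs ++ ys ≡ us ++ vs →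
    (Σ (List A) λ m → us ≡ xs ++ m × ys ≡ m ++ vs) ⊎
    (Σ A λ y → Σ (List A) λ m → xs ≡ us ++ y ∷ m × vs ≡ y ∷ m ++ ys)
  ++-split [] ys us vs eq = inj₁ (us , refl , eq)
  ++-split (x ∷ xs) ys [] vs eq = inj₂ (x , xs , refl , sym eq)
  ++-split (x ∷ xs) ys (u ∷ us) vs eq with ∷-injective eq
  ... | refl , eq′ with ++-split xs ys us vs eq′
  ... | inj₁ (m , e₁ , e₂) = inj₁ (m , cong (x ∷_) e₁ , e₂)
  ... | inj₂ (y , m , e₁ , e₂) = inj₂ (y , m , cong (x ∷_) e₁ , e₂)

  head-∈ : ∀ (xs : List A) {x} → head xs ≡ just x → x ∈ xs
  head-∈ (y ∷ xs) e = here (sym (just-injective e))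

  last-∈ : ∀ (xs : List A) {x} → last xs ≡ just x → x ∈ xs
  last-∈ (y ∷ []) e = here (sym (just-injective e))
  last-∈ (y ∷ y′ ∷ xs) e = there (last-∈ (y′ ∷ xs) e)

  head-++ : ∀ (xs ys : List A) {x} → head xs ≡ just x → head (xs ++ ys) ≡ just x
  head-++ (y ∷ xs) ys e = e

  head-++-cong : ∀ (r : List A) {X Y} → head X ≡ head Y → head (r ++ X) ≡ head (r ++ Y)
  head-++-cong [] e = e
  head-++-cong (a ∷ r) e = refl

  last-++-∷ : ∀ (r : List A) x xs → last (r ++ x ∷ xs) ≡ last (x ∷ xs)
  last-++-∷ [] x xs = refl
  last-++-∷ (a ∷ []) x xs = refl
  last-++-∷ (a ∷ a′ ∷ r) x xs = last-++-∷ (a′ ∷ r) x xs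

  last-++ : ∀ (z : List A) {γ} m → last z ≡ just γ → last (z ++ m) ≡ last (γ ∷ m)
  last-++ z [] e = trans (cong last (++-identityʳ z)) e
  last-++ z (u ∷ m) e = last-++-∷ z u m

  last-∉⇒[] : ∀ (q : List A) γ t → last (q ++ γ ∷ t) ≡ just γ → γ ∉ t → t ≡ []
  last-∉⇒[] q γ [] e γ∉t = refl
  last-∉⇒[] q γ (u ∷ t) e γ∉t =
    ⊥-elim (γ∉t (last-∈ (u ∷ t) (trans (sym (last-++-∷ q γ (u ∷ t))) e)))

  ∈-replace : ∀ (r : List A) {γ z m x} → γ ∈ z → x ∈ r ++ γ ∷ m → x ∈ r ++ z ++ m
  ∈-replace r {γ} {z} {m} γ∈z x∈ with ∈-++⁻ r x∈
  ... | inj₁ x∈r = ∈-++⁺ˡ x∈r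
  ... | inj₂ (here refl) = ∈-++⁺ʳ r (∈-++⁺ˡ γ∈z)
  ... | inj₂ (there x∈m) = ∈-++⁺ʳ r (∈-++⁺ʳ z x∈m)

  Unique-++⁻ʳ : ∀ (p : List A) {l} → Unique (p ++ l) → Unique l
  Unique-++⁻ʳ [] u = u
  Unique-++⁻ʳ (x ∷ p) (_ ∷ u) = Unique-++⁻ʳ p u

  Unique-no-repeat : ∀ (p : List A) {β l} → Unique (p ++ β ∷ l) → β ∉ l
  Unique-no-repeat p u = Unique[x∷xs]⇒x∉xs (Unique-++⁻ʳ p u)

  -- l = p γ m γ s where γ is the first entry of l that repeats, shown at
  -- its first and last occurrence; no entry of p occurs again later.
  FirstRepeat : List A → Set
  FirstRepeat l = Σ (List A) λ p → Σ A λ γ → Σ (List A) λ m → Σ (List A) λ s →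
    l ≡ p ++ γ ∷ (m ++ γ ∷ s) × γ ∉ s × (∀ x → x ∈ p → x ∉ γ ∷ (m ++ γ ∷ s))

module _ {A : Set} (_≟ᴬ_ : DecidableEquality A) where

  open import Data.List.Membership.DecPropositional _≟ᴬ_ using (_∈?_)

  private
    last-occurrence : ∀ {x : A} l → x ∈ l → Σ (List A) λ m → Σ (List A) λ s → l ≡ m ++ x ∷ s × x ∉ s
    last-occurrence {x} (y ∷ l) x∈ with x ∈? l
    ... | yes x∈l with last-occurrence l x∈l
    ...   | m , s , e , x∉s = y ∷ m , s , cong (y ∷_) e , x∉s
    last-occurrence {x} (y ∷ l) (here refl) | no x∉l = [] , l , refl , x∉l
    last-occurrence {x} (y ∷ l) (there x∈l) | no x∉l = ⊥-elim (x∉l x∈l)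

  first-repeat : ∀ (l : List A) → Unique l ⊎ FirstRepeat l
  first-repeat [] = inj₁ []
  first-repeat (x ∷ l) with x ∈? l
  ... | yes x∈l with last-occurrence l x∈l
  ...   | m , s , e , x∉s = inj₂ ([] , x , m , s , cong (x ∷_) e , x∉s , λ _ ())
  first-repeat (x ∷ l) | no x∉l with first-repeat l
  ...   | inj₁ u = inj₁ (¬Any⇒All¬ l x∉l ∷ u)
  ...   | inj₂ (p , γ , m , s , e , γ∉s , p-fresh) =
          inj₂ (x ∷ p , γ , m , s , cong (x ∷_) e , γ∉s , fresh)
    where
    fresh : ∀ y → y ∈ x ∷ p → y ∉ γ ∷ (m ++ γ ∷ s)
    fresh y (here refl) y∈ = x∉l (subst (x ∈_) (sym e) (∈-++⁺ʳ p y∈))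
    fresh y (there y∈p) = p-fresh y y∈p

module _ {n : ℕ} (G : Quiver n) where

  private
    V : Set
    V = Fin n

  walk-suffix : ∀ (xs : List V) {y ys} → IsWalk G (xs ++ y ∷ ys) → IsWalk G (y ∷ ys)
  walk-suffix [] w = w
  walk-suffix (x ∷ []) w = proj₂ w
  walk-suffix (x ∷ x′ ∷ xs) w = walk-suffix (x′ ∷ xs) (proj₂ w)

  walk-prefix : ∀ x (xs ys : List V) → IsWalk G ((x ∷ xs) ++ ys) → IsWalk G (x ∷ xs)
  walk-prefix x [] ys w = tt
  walk-prefix x (x′ ∷ xs) ys w = proj₁ w , walk-prefix x′ xs ys (proj₂ w)

  walk-infix : ∀ (p b s : List V) → b ≢ [] → IsWalk G (p ++ b ++ s) → IsWalk G b
  walk-infix p [] s b≢[] w = ⊥-elim (b≢[] refl)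
  walk-infix p (x ∷ b) s b≢[] w = walk-prefix x b s (walk-suffix p w)

  walk-from-last : ∀ (b s : List V) {β} → last b ≡ just β → IsWalk G (b ++ s) → IsWalk G (β ∷ s)
  walk-from-last (x ∷ []) s e w with just-injective e
  ... | refl = w
  walk-from-last (x ∷ x′ ∷ b) s e w = walk-from-last (x′ ∷ b) s e (proj₂ w)

  -- Contracting a cycle off β inside a walk to the single vertex β leaves a
  -- walk; this recovers the outer factor a from a product a ⊙ b.
  walk-contract : ∀ (p b s : List V) {β} → IsWalk G (p ++ b ++ s) →
    head b ≡ just β → last b ≡ just β → IsWalk G (p ++ β ∷ s)
  walk-contract [] b s w h l = walk-from-last b s l w
  walk-contract (x ∷ []) (y ∷ b) s w h l with just-injective h
  ... | refl = proj₁ w , walk-from-last (y ∷ b) s l (proj₂ w)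
  walk-contract (x ∷ x′ ∷ p) b s w h l = proj₁ w , walk-contract (x′ ∷ p) b s (proj₂ w) h l

  walk-length : ∀ {w : List V} → IsWalk G w → 1 ≤ length w
  walk-length {x ∷ w} _ = s≤s z≤n

  trivial-of-≤1 : ∀ {w : List V} → IsWalk G w → length w ≤ 1 → Trivial G w
  trivial-of-≤1 ww w≤1 = ≤-antisym w≤1 (walk-length ww)

  -- Lengths under nesting: the cycle b replaces one vertex of a.
  nest-length : ∀ {a b c} → Nest G a b c → length a + length b ≡ suc (length c)
  nest-length {b = b} (_ , β , p , s , _ , refl , _ , _ , refl) =
    begin
      length (p ++ β ∷ s) + length b
    ≡⟨ cong (_+ length b) (trans (length-++ p) (+-suc (length p) (length s))) ⟩
      suc ((length p + length s) + length b)
    ≡⟨ cong suc (+-assoc (length p) (length s) (length b)) ⟩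
      suc (length p + (length s + length b))
    ≡⟨ cong (λ k → suc (length p + k)) (+-comm (length s) (length b)) ⟩
      suc (length p + (length b + length s))
    ≡⟨ cong suc (sym (trans (length-++ p) (cong (length p +_) (length-++ b)))) ⟩
      suc (length (p ++ b ++ s))
    ∎
    where open ≡-Reasoning

  private
    sum-bound : ∀ {A B C k} → A + B ≡ suc C → suc k ≤ B → k + A ≤ C
    sum-bound {A} {B} e k<B = s≤s⁻¹ (≤-trans (+-monoˡ-≤ A k<B) (≤-reflexive (trans (+-comm B A) e)))

  nest-left-≤ : ∀ {a b c} → Nest G a b c → length a ≤ length c
  nest-left-≤ nab@(_ , _ , _ , _ , (wb , _) , _) = sum-bound (nest-length nab) (walk-length wb)

  nest-right-≤ : ∀ {a b c} → Nest G a b c → length b ≤ length c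
  nest-right-≤ {a} {b} nab@(wa , _) =
    sum-bound (trans (+-comm (length b) (length a)) (nest-length nab)) (walk-length wa)

  nest-left-< : ∀ {a b c} → Nest G a b c → 2 ≤ length b → length a < length c
  nest-left-< nab 2≤b = sum-bound (nest-length nab) 2≤b

  nest-right-< : ∀ {a b c} → Nest G a b c → 2 ≤ length a → length b < length c
  nest-right-< {a} {b} nab 2≤a = sum-bound (trans (+-comm (length b) (length a)) (nest-length nab)) 2≤a

  -- A divisor is a right factor of a left factor or
  -- a left factor of a right factor; this is how Divides is built.
  LeftFactor : List V → List V → Set
  LeftFactor w v = Σ (Maybe (List V)) λ m → RightMul G w m v

  RightFactor : List V → List V → Set
  RightFactor w v = Σ (Maybe (List V)) λ m → LeftMul G m w v

  left-refl : ∀ {w} → LeftFactor w w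
  left-refl = nothing , refl

  right-refl : ∀ {w} → RightFactor w w
  right-refl = nothing , refl

  left-nest : ∀ {w y v} → Nest G w y v → LeftFactor w v
  left-nest {y = y} nwy = just y , nwy

  right-nest : ∀ {x w v} → Nest G x w v → RightFactor w v
  right-nest {x = x} nxw = just x , nxw

  divides-right-left : ∀ {w x c} → RightFactor w x → LeftFactor x c → Divides G w c
  divides-right-left (a , wx) (b , xc) = a , b , inj₁ (_ , wx , xc)

  divides-left-right : ∀ {w y c} → LeftFactor w y → RightFactor y c → Divides G w c
  divides-left-right (b , wy) (a , yc) = a , b , inj₂ (_ , wy , yc)

  divides-cases : ∀ {w c} → Divides G w c →
    (Σ (List V) λ x → RightFactor w x × LeftFactor x c) ⊎
    (Σ (List V) λ y → LeftFactor w y × RightFactor y c)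
  divides-cases (a , b , inj₁ (x , wx , xc)) = inj₁ (x , (a , wx) , (b , xc))
  divides-cases (a , b , inj₂ (y , wy , yc)) = inj₂ (y , (b , wy) , (a , yc))

  left-factor-≤ : ∀ {w v} → LeftFactor w v → length w ≤ length v
  left-factor-≤ (nothing , refl) = ≤-reflexive refl
  left-factor-≤ (just y , nwy) = nest-left-≤ nwy

  right-factor-≤ : ∀ {w v} → RightFactor w v → length w ≤ length v
  right-factor-≤ (nothing , refl) = ≤-reflexive refl
  right-factor-≤ (just x , nxw) = nest-right-≤ nxw

  divides-≤ : ∀ {w c} → Divides G w c → length w ≤ length c
  divides-≤ d with divides-cases d
  ... | inj₁ (_ , wx , xc) = ≤-trans (right-factor-≤ wx) (left-factor-≤ xc)
  ... | inj₂ (_ , wy , yc) = ≤-trans (left-factor-≤ wy) (right-factor-≤ yc)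

  Rigid : List V → Set
  Rigid w = ∀ a b → Nest G a b w → (Trivial G b × a ≡ w) ⊎ (b ≡ w × Trivial G a)

  rigid-left-factor : ∀ {x w} → Rigid w → LeftFactor x w → Trivial G x ⊎ x ≡ w
  rigid-left-factor rg (nothing , refl) = inj₂ refl
  rigid-left-factor rg (just y , nxy) with rg _ y nxy
  ... | inj₁ (_ , x≡w) = inj₂ x≡w
  ... | inj₂ (_ , tx) = inj₁ tx

  rigid-right-factor : ∀ {x w} → Rigid w → RightFactor x w → Trivial G x ⊎ x ≡ w
  rigid-right-factor rg (nothing , refl) = inj₂ refl
  rigid-right-factor rg (just a , nax) with rg a _ nax
  ... | inj₁ (tx , _) = inj₁ tx
  ... | inj₂ (x≡w , _) = inj₂ x≡w

  rigid-irreducible : ∀ {w} → IsWalk G w → Rigid w → Irreducible G w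
  rigid-irreducible ww rg = ww , divisor
    where
    divisor : ∀ d → IsWalk G d → Divides G d _ → Trivial G d ⊎ d ≡ _
    divisor d wd dw with divides-cases dw
    ... | inj₁ (x , dx , xw) with rigid-left-factor rg xw
    ...   | inj₁ tx = inj₁ (trivial-of-≤1 wd (≤-trans (right-factor-≤ dx) (≤-reflexive tx)))
    ...   | inj₂ refl = rigid-right-factor rg dx
    divisor d wd dw | inj₂ (y , dy , yw) with rigid-right-factor rg yw
    ...   | inj₁ ty = inj₁ (trivial-of-≤1 wd (≤-trans (left-factor-≤ dy) (≤-reflexive ty)))
    ...   | inj₂ refl = rigid-left-factor rg dy

  RepeatsOnlyAtEnds : List V → Set
  RepeatsOnlyAtEnds w = ∀ p β l s → β ∈ l → w ≡ p ++ β ∷ l ++ s → p ≡ [] × s ≡ []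

  -- A nontrivial cycle nested into a walk repeats its base vertex, so in a
  -- walk repeating only at its ends it must be the whole walk.
  repeatsOnlyAtEnds-rigid : ∀ w → RepeatsOnlyAtEnds w → Rigid w
  repeatsOnlyAtEnds-rigid w roe a b (_ , β , p , s , (_ , hb , lb) , refl , _ , _ , refl) = cases b hb lb roe
    where
    cases : ∀ b → head b ≡ just β → last b ≡ just β → RepeatsOnlyAtEnds (p ++ b ++ s) →
      (Trivial G b × p ++ β ∷ s ≡ p ++ b ++ s) ⊎ (b ≡ p ++ b ++ s × Trivial G (p ++ β ∷ s))
    cases (x ∷ []) hb lb _ with just-injective hb
    ... | refl = inj₁ (refl , refl)
    cases (x ∷ x′ ∷ l) hb lb roe with just-injective hb
    ... | refl with roe p x (x′ ∷ l) s (last-∈ (x′ ∷ l) lb) refl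
    ...   | refl , refl = inj₂ (sym (++-identityʳ _) , refl)

  unique-repeatsOnlyAtEnds : ∀ w → Unique w → RepeatsOnlyAtEnds w
  unique-repeatsOnlyAtEnds w u p β l s β∈l refl =
    ⊥-elim (Unique-no-repeat p u (∈-++⁺ˡ β∈l))

  -- A simple cycle (β₀ i β₀): a repetition not at the ends would lie inside
  -- β₀ i (if something follows it) or inside i β₀ (if something precedes it),
  -- and both lists are repetition free.
  cycle-repeatsOnlyAtEnds : ∀ β₀ i → Unique (β₀ ∷ i) → RepeatsOnlyAtEnds ((β₀ ∷ i) ∷ʳ β₀)
  cycle-repeatsOnlyAtEnds β₀ i u p β l s β∈l eq with initLast s
  ... | s₀ ∷ʳ′ y = ⊥-elim (Unique-no-repeat p (subst Unique init-eq u) (∈-++⁺ˡ β∈l))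
    where
    open ≡-Reasoning
    init-eq : β₀ ∷ i ≡ p ++ β ∷ l ++ s₀
    init-eq = proj₁ (∷ʳ-injective (β₀ ∷ i) (p ++ β ∷ l ++ s₀) (begin
        (β₀ ∷ i) ∷ʳ β₀                  ≡⟨ eq ⟩
        p ++ β ∷ l ++ (s₀ ∷ʳ y)         ≡⟨ cong (λ t → p ++ β ∷ t) (sym (++-assoc l s₀ _)) ⟩
        p ++ (β ∷ l ++ s₀) ∷ʳ y         ≡⟨ sym (++-assoc p (β ∷ l ++ s₀) _) ⟩
        (p ++ β ∷ l ++ s₀) ∷ʳ y         ∎))
  ... | [] with p
  ...   | [] = refl , refl
  ...   | x ∷ p′ = ⊥-elim (Unique-no-repeat p′ (subst Unique tail-eq tail-unique) (∈-++⁺ˡ β∈l))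
    where
    tail-eq : i ∷ʳ β₀ ≡ p′ ++ β ∷ l ++ []
    tail-eq = proj₂ (∷-injective eq)
    tail-unique : Unique (i ∷ʳ β₀)
    tail-unique = Unique.++⁺ (Unique-++⁻ʳ (β₀ ∷ []) u) ([] ∷ [])
      (λ { (v∈i , here refl) → Unique[x∷xs]⇒x∉xs u v∈i })

  trivial-unique : ∀ {w : List V} → Trivial G w → Unique w
  trivial-unique {x ∷ []} _ = [] ∷ []
  trivial-unique {[]} ()
  trivial-unique {x ∷ y ∷ w} ()

  simple-rigid : ∀ w → SimplePath G w ⊎ SimpleCycle G w → Rigid w
  simple-rigid w s = repeatsOnlyAtEnds-rigid w (repeats s)
    where
    repeats : SimplePath G w ⊎ SimpleCycle G w → RepeatsOnlyAtEnds w
    repeats (inj₁ (_ , inj₁ t)) = unique-repeatsOnlyAtEnds w (trivial-unique t)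
    repeats (inj₁ (_ , inj₂ (_ , u))) = unique-repeatsOnlyAtEnds w u
    repeats (inj₂ (_ , inj₁ t)) = unique-repeatsOnlyAtEnds w (trivial-unique t)
    repeats (inj₂ (_ , inj₂ (β , i , refl , u))) = cycle-repeatsOnlyAtEnds β i u

  Canonical : V → List V → List V → List V → Set
  Canonical β a p b = CycleOff G β a ⊎ (∀ x → x ∈ p → x ≢ β → x ∉ b)

  -- The three ways in which two products a ⊙ b and d ⊙ z can be the same walk:
  -- z lies inside the cycle b, b lies inside the cycle z, or the two cycles
  -- are inserted side by side into a common walk e.
  data Diamond (a b d z : List V) : Set where
    z-inside-b   : ∀ b′ → Nest G a b′ d → Nest G b′ z b → Diamond a b d z
    b-inside-z   : ∀ z′ → Nest G d z′ a → Nest G z′ b z → Diamond a b d z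
    side-by-side : ∀ e → Nest G e b d → Nest G e z a → Diamond a b d z

  diamond-swap : ∀ {a b d z} → Diamond d z a b → Diamond a b d z
  diamond-swap (z-inside-b x n₁ n₂) = b-inside-z x n₁ n₂
  diamond-swap (b-inside-z x n₁ n₂) = z-inside-b x n₁ n₂
  diamond-swap (side-by-side e n₁ n₂) = side-by-side e n₂ n₁

  private
    nonempty-middle : ∀ (m : List V) {z} t {γ} → head z ≡ just γ → m ++ z ++ t ≢ []
    nonempty-middle [] {x ∷ z} t h ()
    nonempty-middle (x ∷ m) t h ()

  -- z starts after b ends: b and z sit side by side in e = p β m γ t.
  diamond-disjoint : ∀ {b z : List V} β p γ m t →
    IsWalk G (p ++ β ∷ (m ++ z ++ t)) →
    CycleOff G β b → CycleOff G γ z → β ∉ (m ++ z ++ t) → γ ∉ t →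
    Canonical β (p ++ β ∷ (m ++ z ++ t)) p b →
    Canonical γ ((p ++ (b ++ m)) ++ γ ∷ t) (p ++ (b ++ m)) z →
    Diamond (p ++ β ∷ (m ++ z ++ t)) b ((p ++ (b ++ m)) ++ γ ∷ t) z
  diamond-disjoint {b} {z} β p γ m t wa cb@(wb , hb , lb) cz@(wz , hz , lz) β∉s γ∉t canA canD =
    side-by-side e e⊙b e⊙z
    where
    e = (p ++ β ∷ m) ++ γ ∷ t
    we : IsWalk G e
    we = walk-contract (p ++ β ∷ m) z t (subst (IsWalk G) (sym (++-assoc p (β ∷ m) (z ++ t))) wa) hz lz
    d-eq : (p ++ (b ++ m)) ++ γ ∷ t ≡ p ++ b ++ (m ++ γ ∷ t)
    d-eq = trans (++-assoc p (b ++ m) (γ ∷ t)) (cong (p ++_) (++-assoc b m (γ ∷ t)))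
    canonical-b : Canonical β (p ++ β ∷ (m ++ z ++ t)) p b → Canonical β e p b
    canonical-b (inj₂ f) = inj₂ f
    canonical-b (inj₁ (_ , _ , la)) = ⊥-elim (nonempty-middle m t hz (last-∉⇒[] p β (m ++ z ++ t) la β∉s))
    canonical-z : Canonical γ ((p ++ (b ++ m)) ++ γ ∷ t) (p ++ (b ++ m)) z → Canonical γ e (p ++ β ∷ m) z
    canonical-z (inj₂ f) = inj₂ (λ x x∈ → f x (∈-replace p (head-∈ b hb) x∈))
    canonical-z (inj₁ (_ , hd , ld)) = inj₁ (we , he , le)
      where
      he : head e ≡ just γ
      he = trans (cong head (++-assoc p (β ∷ m) (γ ∷ t)))
           (trans (head-++-cong p (sym (head-++ b (m ++ γ ∷ t) hb)))
           (trans (cong head (sym d-eq)) hd))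
      le : last e ≡ just γ
      le = trans (last-++-∷ (p ++ β ∷ m) γ t) (trans (sym (last-++-∷ (p ++ (b ++ m)) γ t)) ld)
    e⊙b : Nest G e b ((p ++ (b ++ m)) ++ γ ∷ t)
    e⊙b = we , β , p , m ++ γ ∷ t , cb , ++-assoc p (β ∷ m) (γ ∷ t) ,
          (λ x → β∉s (∈-replace m (head-∈ z hz) x)) , canonical-b canA , d-eq
    e⊙z : Nest G e z (p ++ β ∷ (m ++ z ++ t))
    e⊙z = we , γ , p ++ β ∷ m , t , cz , refl , γ∉t , canonical-z canD , sym (++-assoc p (β ∷ m) (z ++ t))

  -- z lies within the cycle b = r y m with y m = z m₂: z is nested into the
  -- cycle b′ = r γ m₂, and b′ into a.
  diamond-nested : ∀ {z : List V} β p s γ r y m m₂ →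
    IsWalk G (p ++ β ∷ s) →
    CycleOff G β (r ++ y ∷ m) → CycleOff G γ z → β ∉ s → γ ∉ (m₂ ++ s) →
    Canonical β (p ++ β ∷ s) p (r ++ y ∷ m) →
    Canonical γ ((p ++ r) ++ γ ∷ (m₂ ++ s)) (p ++ r) z →
    y ∷ m ≡ z ++ m₂ →
    Diamond (p ++ β ∷ s) (r ++ y ∷ m) ((p ++ r) ++ γ ∷ (m₂ ++ s)) z
  diamond-nested {z} β p s γ r y m m₂ wa (wb , hb , lb) cz@(wz , hz , lz) β∉s γ∉t canA canD eq =
    z-inside-b b′ a⊙b′ b′⊙z
    where
    b′ = r ++ γ ∷ m₂
    b-eq : r ++ y ∷ m ≡ r ++ z ++ m₂
    b-eq = cong (r ++_) eq
    wb′ : IsWalk G b′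
    wb′ = walk-contract r z m₂ (subst (IsWalk G) b-eq wb) hz lz
    hb′ : head b′ ≡ just β
    hb′ = trans (head-++-cong r (sym (head-++ z m₂ hz))) (trans (cong head (sym b-eq)) hb)
    lb′ : last b′ ≡ just β
    lb′ = trans (last-++-∷ r γ m₂) (trans (sym (last-++ z m₂ lz))
          (trans (cong last (sym eq)) (trans (sym (last-++-∷ r y m)) lb)))
    canonical-b′ : Canonical β (p ++ β ∷ s) p (r ++ y ∷ m) → Canonical β (p ++ β ∷ s) p b′
    canonical-b′ (inj₁ c) = inj₁ c
    canonical-b′ (inj₂ f) =
      inj₂ (λ x x∈p x≢β x∈ → f x x∈p x≢β (subst (x ∈_) (sym b-eq) (∈-replace r (head-∈ z hz) x∈)))
    -- if d is a cycle off γ then nothing follows the cut, so b′ is a cycle off γ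
    b′-cycle : ∀ m₂′ → m₂ ≡ m₂′ → m₂′ ++ s ≡ [] → CycleOff G γ b′
    b′-cycle [] refl _ = wb′ , trans hb′ (cong just β≡γ) , last-++-∷ r γ []
      where
      β≡γ : β ≡ γ
      β≡γ = just-injective (trans (sym lb′) (last-++-∷ r γ []))
    canonical-z : Canonical γ ((p ++ r) ++ γ ∷ (m₂ ++ s)) (p ++ r) z → Canonical γ b′ r z
    canonical-z (inj₂ f) = inj₂ (λ x x∈r → f x (∈-++⁺ʳ p x∈r))
    canonical-z (inj₁ (_ , _ , ld)) = inj₁ (b′-cycle m₂ refl (last-∉⇒[] (p ++ r) γ (m₂ ++ s) ld γ∉t))
    a⊙b′ : Nest G (p ++ β ∷ s) b′ ((p ++ r) ++ γ ∷ (m₂ ++ s))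
    a⊙b′ = wa , β , p , s , (wb′ , hb′ , lb′) , refl , β∉s , canonical-b′ canA ,
           trans (++-assoc p r (γ ∷ m₂ ++ s)) (cong (p ++_) (sym (++-assoc r (γ ∷ m₂) s)))
    b′⊙z : Nest G b′ z (r ++ y ∷ m)
    b′⊙z = wb′ , γ , r , m₂ , cz , refl , (λ x → γ∉t (∈-++⁺ˡ x)) , canonical-z canD , b-eq

  -- z starts inside b and ends after it: impossible for canonical products.
  -- Either β = γ and β reappears after its last occurrence, or β ≠ γ and the
  -- canonical conditions of both products are violated.
  diamond-no-overlap : ∀ β p γ r y m y₂ m₃ t →
    CycleOff G β (r ++ y ∷ m) → CycleOff G γ ((y ∷ m) ++ y₂ ∷ m₃) → β ∉ (y₂ ∷ m₃ ++ t) →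
    Canonical β (p ++ β ∷ (y₂ ∷ m₃ ++ t)) p (r ++ y ∷ m) →
    Canonical γ ((p ++ r) ++ γ ∷ t) (p ++ r) ((y ∷ m) ++ y₂ ∷ m₃) →
    ⊥
  diamond-no-overlap β p γ r y m y₂ m₃ t (_ , hb , lb) (_ , hz , lz) β∉s canA canD with β ≟ γ
  ... | yes refl = β∉s (∈-++⁺ˡ (last-∈ (y₂ ∷ m₃) (trans (sym (last-++-∷ (y ∷ m) y₂ m₃)) lz)))
  ... | no β≢γ = go p r hb canA canD
    where
    y≡γ : y ≡ γ
    y≡γ = just-injective hz
    β∈z : β ∈ (y ∷ m) ++ y₂ ∷ m₃
    β∈z = ∈-++⁺ˡ (last-∈ (y ∷ m) (trans (sym (last-++-∷ r y m)) lb))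
    go : ∀ p r → head (r ++ y ∷ m) ≡ just β →
      Canonical β (p ++ β ∷ (y₂ ∷ m₃ ++ t)) p (r ++ y ∷ m) →
      Canonical γ ((p ++ r) ++ γ ∷ t) (p ++ r) ((y ∷ m) ++ y₂ ∷ m₃) → ⊥
    go p [] h _ _ = β≢γ (trans (sym (just-injective h)) y≡γ)
    go p (r₀ ∷ r′) h _ (inj₂ f) = f β (∈-++⁺ʳ p (here (sym (just-injective h)))) β≢γ β∈z
    go [] (r₀ ∷ r′) h _ (inj₁ (_ , hd , _)) = β≢γ (trans (sym (just-injective h)) (just-injective hd))
    go (x ∷ p′) (r₀ ∷ r′) h (inj₁ (_ , ha , _)) (inj₁ (_ , hd , _)) =
      β≢γ (trans (sym (just-injective ha)) (just-injective hd))
    go (x ∷ p′) (r₀ ∷ r′) h (inj₂ f) (inj₁ (_ , hd , _)) =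
      f x (here refl) (λ x≡β → β≢γ (trans (sym x≡β) x≡γ))
        (subst (_∈ (r₀ ∷ r′) ++ y ∷ m) (trans y≡γ (sym x≡γ)) (∈-++⁺ʳ (r₀ ∷ r′) (here refl)))
      where
      x≡γ : x ≡ γ
      x≡γ = just-injective hd

  -- The diamond lemma when the cut of a ⊙ b (after p) is not to the right of
  -- the cut of d ⊙ z (after p ++ r): compare where z starts and ends
  -- relative to b.
  diamond-aligned : ∀ {b z : List V} β p s γ r t →
    IsWalk G (p ++ β ∷ s) →
    CycleOff G β b → CycleOff G γ z → β ∉ s → γ ∉ t →
    Canonical β (p ++ β ∷ s) p b →
    Canonical γ ((p ++ r) ++ γ ∷ t) (p ++ r) z →
    p ++ b ++ s ≡ (p ++ r) ++ z ++ t →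
    Diamond (p ++ β ∷ s) b ((p ++ r) ++ γ ∷ t) z
  diamond-aligned {b} {z} β p s γ r t wa cb cz β∉s γ∉t canA canD eq
    with ++-split b s r (z ++ t) (++-cancelˡ p _ _ (trans eq (++-assoc p r (z ++ t))))
  ... | inj₁ (m , refl , refl) = diamond-disjoint β p γ m t wa cb cz β∉s γ∉t canA canD
  ... | inj₂ (y , m , refl , eq₂) with ++-split z t (y ∷ m) s eq₂
  ...   | inj₁ (m₂ , eq₃ , refl) = diamond-nested β p s γ r y m m₂ wa cb cz β∉s γ∉t canA canD eq₃
  ...   | inj₂ (y₂ , m₃ , refl , refl) =
          ⊥-elim (diamond-no-overlap β p γ r y m y₂ m₃ t cb cz β∉s canA canD)

  -- The diamond lemma: any two factorisations of one walk are related; the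
  -- general case reduces to the aligned one by swapping the products.
  diamond : ∀ {a b c d z} → Nest G a b c → Nest G d z c → Diamond a b d z
  diamond {b = b} {z = z} (wa , β , p , s , cb , refl , β∉s , canA , refl)
                          (wd , γ , q , t , cz , refl , γ∉t , canD , eq)
    with ++-split p (b ++ s) q (z ++ t) eq
  ... | inj₁ (r , refl , _) = diamond-aligned β p s γ r t wa cb cz β∉s γ∉t canA canD eq
  ... | inj₂ (y , m , refl , _) =
    diamond-swap (diamond-aligned γ q t β (y ∷ m) s wd cz cb γ∉t β∉s canD canA (sym eq))

  rigid-right-factor-split : ∀ {w a b D} → Rigid w → RightFactor w D → Nest G a b D →
    RightFactor w a ⊎ RightFactor w b
  rigid-right-factor-split rg (nothing , refl) nab with rg _ _ nab
  ... | inj₁ (_ , refl) = inj₁ right-refl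
  ... | inj₂ (refl , _) = inj₂ right-refl
  rigid-right-factor-split rg (just x , nxw) nab with diamond nab nxw
  ... | z-inside-b b′ _ b′⊙w = inj₂ (right-nest b′⊙w)
  ... | side-by-side e _ e⊙w = inj₁ (right-nest e⊙w)
  ... | b-inside-z z′ x⊙z′ z′⊙b with rg z′ _ z′⊙b
  ...   | inj₁ (_ , refl) = inj₁ (right-nest x⊙z′)
  ...   | inj₂ (refl , _) = inj₂ right-refl

  rigid-left-factor-split : ∀ {w a b Y} → Rigid w → LeftFactor w Y → Nest G a b Y →
    LeftFactor w a ⊎ LeftFactor w b
  rigid-left-factor-split rg (nothing , refl) nab with rg _ _ nab
  ... | inj₁ (_ , refl) = inj₁ left-refl
  ... | inj₂ (refl , _) = inj₂ left-refl
  rigid-left-factor-split rg (just y , nwy) nab with diamond nab nwy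
  ... | b-inside-z y′ w⊙y′ _ = inj₁ (left-nest w⊙y′)
  ... | z-inside-b b′ a⊙b′ b′⊙y with rg _ b′ a⊙b′
  ...   | inj₁ (_ , refl) = inj₁ left-refl
  ...   | inj₂ (refl , _) = inj₂ (left-nest b′⊙y)
  rigid-left-factor-split rg (just y , nwy) nab | side-by-side e e⊙b e⊙y with rg e _ e⊙b
  ...   | inj₁ (_ , refl) = inj₁ (left-nest e⊙y)
  ...   | inj₂ (refl , _) = inj₂ left-refl

  -- A divisor w of c = a ⊙ b is a right factor of a
  -- left factor D of c, or a left factor of a right factor Y of c; the
  -- diamond lemma compares D ⊙ y = c (resp. x ⊙ Y = c) with a ⊙ b = c.
  rigid-prime : ∀ {w} → IsWalk G w → Rigid w → Prime G w
  rigid-prime {w} ww rg = ww , prime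
    where
    right-case : ∀ {a b c D} → Nest G a b c → RightFactor w D → LeftFactor D c →
      Divides G w a ⊎ Divides G w b
    right-case nab wD (nothing , refl) with rigid-right-factor-split rg wD nab
    ... | inj₁ wa = inj₁ (divides-right-left wa left-refl)
    ... | inj₂ wb = inj₂ (divides-right-left wb left-refl)
    right-case nab wD (just y , nDy) with diamond nab nDy
    ... | b-inside-z y′ D⊙y′ _ = inj₁ (divides-right-left wD (left-nest D⊙y′))
    ... | z-inside-b b′ a⊙b′ b′⊙y with rigid-right-factor-split rg wD a⊙b′
    ...   | inj₁ wa = inj₁ (divides-right-left wa left-refl)
    ...   | inj₂ wb′ = inj₂ (divides-right-left wb′ (left-nest b′⊙y))
    right-case nab wD (just y , nDy) | side-by-side e e⊙b e⊙y with rigid-right-factor-split rg wD e⊙b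
    ...   | inj₁ we = inj₁ (divides-right-left we (left-nest e⊙y))
    ...   | inj₂ wb = inj₂ (divides-right-left wb left-refl)

    left-case : ∀ {a b c Y} → Nest G a b c → LeftFactor w Y → RightFactor Y c →
      Divides G w a ⊎ Divides G w b
    left-case nab wY (nothing , refl) with rigid-left-factor-split rg wY nab
    ... | inj₁ wa = inj₁ (divides-left-right wa right-refl)
    ... | inj₂ wb = inj₂ (divides-left-right wb right-refl)
    left-case nab wY (just x , nxY) with diamond nab nxY
    ... | z-inside-b b′ _ b′⊙Y = inj₂ (divides-left-right wY (right-nest b′⊙Y))
    ... | side-by-side e _ e⊙Y = inj₁ (divides-left-right wY (right-nest e⊙Y))
    ... | b-inside-z Y′ x⊙Y′ Y′⊙b with rigid-left-factor-split rg wY Y′⊙b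
    ...   | inj₁ wY′ = inj₁ (divides-left-right wY′ (right-nest x⊙Y′))
    ...   | inj₂ wb = inj₂ (divides-left-right wb right-refl)

    prime : ∀ a b c → Nest G a b c → Divides G w c → Divides G w a ⊎ Divides G w b
    prime a b c nab wc with divides-cases wc
    ... | inj₁ (D , wD , Dc) = right-case nab wD Dc
    ... | inj₂ (Y , wY , Yc) = left-case nab wY Yc

  ProperFactorisation : List V → Set
  ProperFactorisation w = Σ (List V) λ a → Σ (List V) λ b → Nest G a b w × 2 ≤ length a × 2 ≤ length b

  open import Data.List.Membership.DecPropositional (_≟_ {n}) using (_∈?_)

  private
    cycle-⊆ : ∀ {x : V} γ m s → x ∈ γ ∷ (m ++ γ ∷ []) → x ∈ γ ∷ (m ++ γ ∷ s)
    cycle-⊆ γ m s (here e) = here e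
    cycle-⊆ γ m s (there x∈) with ∈-++⁻ m x∈
    ... | inj₁ x∈m = there (∈-++⁺ˡ x∈m)
    ... | inj₂ (here e) = there (∈-++⁺ʳ m (here e))

    cycle-length : ∀ (γ : V) m → 2 ≤ length (γ ∷ (m ++ γ ∷ []))
    cycle-length γ [] = s≤s (s≤s z≤n)
    cycle-length γ (x ∷ m) = s≤s (s≤s z≤n)

    cons-length : ∀ (x y : V) p s → 2 ≤ length ((x ∷ p) ++ y ∷ s)
    cons-length x y [] s = s≤s (s≤s z≤n)
    cons-length x y (z ∷ p) s = s≤s (s≤s z≤n)

  cut-cycle : ∀ p γ m s → IsWalk G (p ++ γ ∷ (m ++ γ ∷ s)) → γ ∉ s →
    (IsWalk G (p ++ γ ∷ s) → Canonical γ (p ++ γ ∷ s) p (γ ∷ (m ++ γ ∷ []))) →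
    Nest G (p ++ γ ∷ s) (γ ∷ (m ++ γ ∷ [])) (p ++ γ ∷ (m ++ γ ∷ s))
  cut-cycle p γ m s ww γ∉s canonical =
    wa , γ , p , s , (wb , refl , last-++-∷ (γ ∷ m) γ []) , refl , γ∉s , canonical wa , w-eq
    where
    w-eq : p ++ γ ∷ (m ++ γ ∷ s) ≡ p ++ (γ ∷ (m ++ γ ∷ [])) ++ s
    w-eq = cong (p ++_) (cong (γ ∷_) (sym (++-assoc m (γ ∷ []) s)))
    ww′ : IsWalk G (p ++ (γ ∷ (m ++ γ ∷ [])) ++ s)
    ww′ = subst (IsWalk G) w-eq ww
    wa : IsWalk G (p ++ γ ∷ s)
    wa = walk-contract p (γ ∷ (m ++ γ ∷ [])) s ww′ refl (last-++-∷ (γ ∷ m) γ [])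
    wb : IsWalk G (γ ∷ (m ++ γ ∷ []))
    wb = walk-infix p (γ ∷ (m ++ γ ∷ [])) s (λ ()) ww′

  -- At a first repeat, the cut-out cycle meets the prefix p nowhere.
  cut-first-repeat : ∀ p γ m s → IsWalk G (p ++ γ ∷ (m ++ γ ∷ s)) → γ ∉ s →
    (∀ x → x ∈ p → x ∉ γ ∷ (m ++ γ ∷ s)) →
    Nest G (p ++ γ ∷ s) (γ ∷ (m ++ γ ∷ [])) (p ++ γ ∷ (m ++ γ ∷ s))
  cut-first-repeat p γ m s ww γ∉s p-fresh =
    cut-cycle p γ m s ww γ∉s (λ _ → inj₂ (λ x x∈p _ x∈ → p-fresh x x∈p (cycle-⊆ γ m s x∈)))

  Classification : List V → Set
  Classification w = (SimplePath G w ⊎ SimpleCycle G w) ⊎ ProperFactorisation w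

  -- A closed walk γ m γ: either a simple cycle, or γ recurs in m and it is a
  -- product of two cycles off γ, or m has a first repeat δ whose cycle is cut
  -- out of γ ⋯ δ ⋯ γ.
  classify-cycle : ∀ γ m → IsWalk G (γ ∷ (m ++ γ ∷ [])) → Classification (γ ∷ (m ++ γ ∷ []))
  classify-cycle γ m ww with γ ∈? m
  ... | yes γ∈m with ∈-∃++ γ∈m
  ...   | m₁ , m₂ , refl =
          inj₂ (_ , _ , subst (Nest G _ _) w-eq two-cycles , cons-length γ γ m₁ [] , cycle-length γ m₂)
    where
    w-eq : (γ ∷ m₁) ++ γ ∷ (m₂ ++ γ ∷ []) ≡ γ ∷ ((m₁ ++ γ ∷ m₂) ++ γ ∷ [])
    w-eq = cong (γ ∷_) (sym (++-assoc m₁ (γ ∷ m₂) (γ ∷ [])))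
    two-cycles : Nest G ((γ ∷ m₁) ++ γ ∷ []) (γ ∷ (m₂ ++ γ ∷ [])) ((γ ∷ m₁) ++ γ ∷ (m₂ ++ γ ∷ []))
    two-cycles = cut-cycle (γ ∷ m₁) γ m₂ [] (subst (IsWalk G) (sym w-eq) ww) (λ ())
                   (λ wa → inj₁ (wa , refl , last-++-∷ (γ ∷ m₁) γ []))
  classify-cycle γ m ww | no γ∉m with first-repeat _≟_ m
  ... | inj₁ u = inj₁ (inj₂ (ww , inj₂ (γ , m , refl , ¬Any⇒All¬ m γ∉m ∷ u)))
  ... | inj₂ (p , δ , m′ , s , refl , δ∉s , p-fresh) =
          inj₂ (_ , _ , subst (Nest G _ _) w-eq inner , cons-length γ δ p (s ++ γ ∷ []) , cycle-length δ m′)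
    where
    w-eq : (γ ∷ p) ++ δ ∷ (m′ ++ δ ∷ (s ++ γ ∷ [])) ≡ γ ∷ ((p ++ δ ∷ (m′ ++ δ ∷ s)) ++ γ ∷ [])
    w-eq = cong (γ ∷_) (sym (trans (++-assoc p (δ ∷ (m′ ++ δ ∷ s)) (γ ∷ []))
             (cong (λ q → p ++ δ ∷ q) (++-assoc m′ (δ ∷ s) (γ ∷ [])))))
    δ∉s′ : δ ∉ s ++ γ ∷ []
    δ∉s′ δ∈ with ∈-++⁻ s δ∈
    ... | inj₁ δ∈s = δ∉s δ∈s
    ... | inj₂ (here refl) = γ∉m (∈-++⁺ʳ p (here refl))
    -- the cycle δ m′ δ lies inside m, hence avoids γ and, by p-fresh, p
    canonical : ∀ x → x ∈ γ ∷ p → x ≢ δ → x ∉ δ ∷ (m′ ++ δ ∷ [])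
    canonical x (here refl) _ x∈ = γ∉m (∈-++⁺ʳ p (cycle-⊆ δ m′ s x∈))
    canonical x (there x∈p) _ x∈ = p-fresh x x∈p (cycle-⊆ δ m′ s x∈)
    inner : Nest G ((γ ∷ p) ++ δ ∷ (s ++ γ ∷ [])) (δ ∷ (m′ ++ δ ∷ [])) ((γ ∷ p) ++ δ ∷ (m′ ++ δ ∷ (s ++ γ ∷ [])))
    inner = cut-cycle (γ ∷ p) δ m′ (s ++ γ ∷ []) (subst (IsWalk G) (sym w-eq) ww) δ∉s′
              (λ _ → inj₂ canonical)

  unique-simple-path : ∀ {w} → IsWalk G w → Unique w → SimplePath G w
  unique-simple-path {x ∷ []} ww u = ww , inj₁ refl
  unique-simple-path {x ∷ y ∷ r} ww u =
    ww , inj₂ ((λ e → Unique[x∷xs]⇒x∉xs u (last-∈ (y ∷ r) (sym e))) , u)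

  -- A walk with a first repeat p γ m γ s: if p or s is nonempty, cutting out
  -- γ m γ is a proper factorisation; otherwise the walk is the cycle γ m γ.
  classify-repeat : ∀ p γ m s → IsWalk G (p ++ γ ∷ (m ++ γ ∷ s)) → γ ∉ s →
    (∀ x → x ∈ p → x ∉ γ ∷ (m ++ γ ∷ s)) → Classification (p ++ γ ∷ (m ++ γ ∷ s))
  classify-repeat (x ∷ p) γ m s ww γ∉s p-fresh =
    inj₂ (_ , _ , cut-first-repeat (x ∷ p) γ m s ww γ∉s p-fresh , cons-length x γ p s , cycle-length γ m)
  classify-repeat [] γ m (u ∷ s) ww γ∉s p-fresh =
    inj₂ (_ , _ , cut-first-repeat [] γ m (u ∷ s) ww γ∉s p-fresh , s≤s (s≤s z≤n) , cycle-length γ m)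
  classify-repeat [] γ m [] ww _ _ = classify-cycle γ m ww

  classify : ∀ w → IsWalk G w → Classification w
  classify w ww with first-repeat _≟_ w
  ... | inj₁ u = inj₁ (inj₁ (unique-simple-path ww u))
  ... | inj₂ (p , γ , m , s , refl , γ∉s , p-fresh) = classify-repeat p γ m s ww γ∉s p-fresh

  -- A properly factorisable walk is not irreducible: its right factor b is a
  -- nontrivial divisor strictly shorter than it.
  proper-not-irreducible : ∀ {w} → ProperFactorisation w → Irreducible G w → ⊥
  proper-not-irreducible (a , b , nab@(_ , _ , _ , _ , (wb , _) , _) , 2≤a , 2≤b) (_ , irreducible)
    with irreducible b wb (divides-right-left (right-nest nab) left-refl)
  ... | inj₁ tb = <-irrefl (sym tb) 2≤b
  ... | inj₂ refl = <-irrefl refl (nest-right-< nab 2≤a)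

  -- Nor is it prime: w divides a ⊙ b = w, yet both factors are shorter than w.
  proper-not-prime : ∀ {w} → ProperFactorisation w → Prime G w → ⊥
  proper-not-prime (a , b , nab , 2≤a , 2≤b) (_ , prime)
    with prime a b _ nab (divides-right-left right-refl left-refl)
  ... | inj₁ w∣a = <-irrefl refl (≤-<-trans (divides-≤ w∣a) (nest-left-< nab 2≤b))
  ... | inj₂ w∣b = <-irrefl refl (≤-<-trans (divides-≤ w∣b) (nest-right-< nab 2≤a))

  simple-unless-factorisable : ∀ {w} → IsWalk G w → (ProperFactorisation w → ⊥) →
    SimplePath G w ⊎ SimpleCycle G w
  simple-unless-factorisable {w} ww not-proper with classify w ww
  ... | inj₁ simple = simple
  ... | inj₂ proper = ⊥-elim (not-proper proper)

proposition1 : (n : ℕ) (G : Quiver n) (w : List (Fin n)) → IsWalk G w →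
    (Irreducible G w ⇔ (SimplePath G w ⊎ SimpleCycle G w))
    × (Irreducible G w ⇔ Prime G w)
proposition1 n G w ww =
  mk⇔ irreducible⇒simple simple⇒irreducible ,
  mk⇔ (simple⇒prime ∘ irreducible⇒simple) (simple⇒irreducible ∘ prime⇒simple)
  where
  Simple : Set
  Simple = SimplePath G w ⊎ SimpleCycle G w

  simple⇒irreducible : Simple → Irreducible G w
  simple⇒irreducible s = rigid-irreducible G ww (simple-rigid G w s)

  simple⇒prime : Simple → Prime G w
  simple⇒prime s = rigid-prime G ww (simple-rigid G w s)

  irreducible⇒simple : Irreducible G w → Simple
  irreducible⇒simple i = simple-unless-factorisable G ww (λ f → proper-not-irreducible G f i)

  prime⇒simple : Prime G w → Simple
  prime⇒simple p = simple-unless-factorisable G ww (λ f → proper-not-prime G f p)
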